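{- For every integer $n \ge 0$, $$B_n \subset Oct_n \subset B_{n+1} \cup \{ (1+i)^{n+2} u : u \in \{\pm1,\pm i\} \}.$$ Moreover, if $a+bi \in Oct_n$ and $a,b$ are not both even, then $a+bi \in B_n$.
   Context: For $n\ge 0$, $B_n = \left\{ \sum_{j=0}^n v_j (1+i)^j : v_j \in \{0,\pm 1,\pm i\}\right\} \subset \mathbb{Z}[i]$. The sequence $(w_k)_{k\ge0}$ is defined by $w_{2m} = 2^{m+1}+2^m$ and $w_{2m+1} = 2^{m+2}$. The $n$-th octagon is $Oct_n = \{x+yi \in \mathbb{Z}[i] : |x|,|y| \le w_n - 2,\ |x|+|y| \le w_{n+1}-3\}$. -}

module Defs where

open import Data.Nat as ℕ using (ℕ; zero; suc)
open import Data.Integer using (ℤ; +_; -_; _+_; _-_; _*_; ∣_∣; _≤_; 0ℤ; 1ℤ; -1ℤ)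
open import Data.Product using (_×_; _,_; Σ; ∃; ∃-syntax)
open import Data.Sum using (_⊎_)
open import Data.Vec using (Vec; []; _∷_)
open import Relation.Binary.PropositionalEquality using (_≡_)
open import Relation.Nullary using (¬_)

record ℤ[i] : Set where
  constructor _+_i
  field
    re : ℤ
    im : ℤ
open ℤ[i] public

infixl 6 _⊕_
infixl 7 _⊗_

_⊕_ : ℤ[i] → ℤ[i] → ℤ[i]
(a + b i) ⊕ (c + d i) = (a + c) + (b + d) i

_⊗_ : ℤ[i] → ℤ[i] → ℤ[i]
(a + b i) ⊗ (c + d i) = (a * c - b * d) + (a * d + b * c) i

zeroG oneG iG onePlusI : ℤ[i]
zeroG = 0ℤ + 0ℤ i
oneG  = 1ℤ + 0ℤ i
iG    = 0ℤ + 1ℤ i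
onePlusI = 1ℤ + 1ℤ i

pow1+i : ℕ → ℤ[i]
pow1+i zero    = oneG
pow1+i (suc k) = onePlusI ⊗ pow1+i k

data Digit : Set where
  d0 d1 d-1 di d-i : Digit

digitVal : Digit → ℤ[i]
digitVal d0  = 0ℤ + 0ℤ i
digitVal d1  = 1ℤ + 0ℤ i
digitVal d-1 = -1ℤ + 0ℤ i
digitVal di  = 0ℤ + 1ℤ i
digitVal d-i = 0ℤ + -1ℤ i

-- Σ_{j} v_j (1+i)^j, with v = (v_0, v_1, …, v_m) (v_0 first)
evalDigits : ∀ {m} → Vec Digit m → ℤ[i]
evalDigits []       = zeroG
evalDigits (v ∷ vs) = digitVal v ⊕ onePlusI ⊗ evalDigits vs

InB : ℕ → ℤ[i] → Set
InB n z = ∃[ v ] (evalDigits {suc n} v ≡ z)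

-- w_{2m} = 2^{m+1} + 2^m,  w_{2m+1} = 2^{m+2}
w : ℕ → ℕ
w zero          = 3
w (suc zero)    = 4
w (suc (suc k)) = 2 ℕ.* w k

InOct : ℕ → ℤ[i] → Set
InOct n (x + y i) =
  (+ ∣ x ∣ ≤ + w n - + 2) × (+ ∣ y ∣ ≤ + w n - + 2) ×
  (+ ∣ x ∣ + + ∣ y ∣ ≤ + w (suc n) - + 3)

IsUnit : ℤ[i] → Set
IsUnit u = (u ≡ oneG) ⊎ (u ≡ (-1ℤ + 0ℤ i)) ⊎ (u ≡ iG) ⊎ (u ≡ (0ℤ + -1ℤ i))

Even : ℤ → Set
Even a = ∃[ k ] (a ≡ + 2 * k)

{-# OPTIONS --safe #-}

-- Write Octagon c d for the points x + yi with |x|, |y| ≤ c and |x ± y| ≤ d (equivalently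
-- |x| + |y| ≤ d); then Oct_n = Octagon (box n) (diag n), where box (n+1) = diag n + 1 and
-- diag (n+1) = 2 box n + 1. Multiplication by 1+i sends x + yi to (x − y) + (x + y)i, so it
-- exchanges the two kinds of constraints and doubles one of them: (1+i)·Octagon c d lies in
-- Octagon d (2c), and (1+i)q ∈ Octagon c (2h+1) forces q ∈ Octagon h c. As a digit raises
-- both bounds by one, B_n ⊆ Oct_n follows by induction.
-- Conversely, a point of Oct_{n+1} outside (2ℤ)² is, after a rotation by a power of i, either
-- odd in both coordinates or even and nonnegative in the first. Subtracting the digit 0 or 1
-- leaves a point with odd coordinates which, as the bounds have known parities, lies in
-- Octagon (diag n) (2 box n + 1); it is therefore (1+i)q with q ∈ Oct_n outside (2ℤ)².
-- Even points of the slightly larger Octagon (box n + 1) (diag n + 1) are divided by 1+i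
-- and handled recursively, down to ±2, ±2i = (1+i)²·units.

module Submission where

open import Defs
open import Data.Nat.Base as ℕ using (ℕ; zero; suc; _≤_; _<_; z≤n; s≤s; s≤s⁻¹)
import Data.Nat.Properties as ℕₚ
open import Data.Integer.Base as ℤ
  using (ℤ; +_; -[1+_]; -_; _+_; _-_; _*_; ∣_∣; 0ℤ; 1ℤ; -1ℤ; +≤+; -≤-)
open import Data.Integer.Properties as ℤₚ
  using ( +-comm; +-identityˡ; +-identityʳ; +-monoˡ-≤; i≤j⇒i-k≤j; neg-involutive; neg-distrib-+
        ; pos-*; drop‿+≤+; ∣-i∣≡∣i∣; ∣i+j∣≤∣i∣+∣j∣; ∣i-j∣≤∣i∣+∣j∣; ∣i-j∣≡∣j-i∣; ∣i*j∣≡∣i∣*∣j∣)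
open import Data.Integer.Tactic.RingSolver using (solve-∀)
open import Data.Product using (_×_; _,_; ∃-syntax)
open import Data.Sum as Sum using (_⊎_; inj₁; inj₂)
open import Data.Vec.Base using (Vec; _∷_; []; map)
open import Data.Empty using (⊥-elim)
open import Relation.Binary.PropositionalEquality
  using (_≡_; refl; sym; trans; cong; cong₂; subst; module ≡-Reasoning)
open import Relation.Nullary using (¬_)

open ≡-Reasoning

Odd : ℤ → Set
Odd a = ∃[ k ] (a ≡ + 2 * k + 1ℤ)

odd-1+ : ∀ {a} → Even a → Odd (1ℤ + a)
odd-1+ (k , refl) = k , +-comm 1ℤ (+ 2 * k)

even-1+ : ∀ {a} → Odd a → Even (1ℤ + a)
even-1+ (k , refl) = k + 1ℤ , identity k
  where
  identity : ∀ k → 1ℤ + (+ 2 * k + 1ℤ) ≡ + 2 * (k + 1ℤ)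
  identity = solve-∀

odd-pred : ∀ {a} → Even a → Odd (a - 1ℤ)
odd-pred (k , refl) = k - 1ℤ , identity k
  where
  identity : ∀ k → + 2 * k - 1ℤ ≡ + 2 * (k - 1ℤ) + 1ℤ
  identity = solve-∀

even-neg : ∀ {a} → Even a → Even (- a)
even-neg (k , refl) = - k , identity k
  where
  identity : ∀ k → - (+ 2 * k) ≡ + 2 * - k
  identity = solve-∀

odd-neg : ∀ {a} → Odd a → Odd (- a)
odd-neg (k , refl) = - k - 1ℤ , identity k
  where
  identity : ∀ k → - (+ 2 * k + 1ℤ) ≡ + 2 * (- k - 1ℤ) + 1ℤ
  identity = solve-∀

even+even : ∀ {a b} → Even a → Even b → Even (a + b)
even+even (k , refl) (l , refl) = k + l , identity k l
  where
  identity : ∀ k l → + 2 * k + + 2 * l ≡ + 2 * (k + l)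
  identity = solve-∀

odd+odd : ∀ {a b} → Odd a → Odd b → Even (a + b)
odd+odd (k , refl) (l , refl) = k + l + 1ℤ , identity k l
  where
  identity : ∀ k l → (+ 2 * k + 1ℤ) + (+ 2 * l + 1ℤ) ≡ + 2 * (k + l + 1ℤ)
  identity = solve-∀

parity-+ : ∀ n → Even (+ n) ⊎ Odd (+ n)
parity-+ zero    = inj₁ (0ℤ , refl)
parity-+ (suc n) = Sum.swap (Sum.map odd-1+ even-1+ (parity-+ n))

parity : ∀ a → Even a ⊎ Odd a
parity (+ n)     = parity-+ n
parity -[1+ n ]  = Sum.map even-neg odd-neg (parity-+ (suc n))

even⇒¬odd : ∀ {a} → Even a → ¬ Odd a
even⇒¬odd (k , refl) (l , eq) with ℕₚ.m*n≡1⇒m≡1 2 ∣ k - l ∣ twice∣k-l∣≡1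
  where
  factor : ∀ k l → + 2 * (k - l) ≡ + 2 * k - + 2 * l
  factor = solve-∀
  cancel : ∀ l → + 2 * l + 1ℤ - + 2 * l ≡ 1ℤ
  cancel = solve-∀
  twice∣k-l∣≡1 : 2 ℕ.* ∣ k - l ∣ ≡ 1
  twice∣k-l∣≡1 = begin
    2 ℕ.* ∣ k - l ∣            ≡⟨ sym (∣i*j∣≡∣i∣*∣j∣ (+ 2) (k - l)) ⟩
    ∣ + 2 * (k - l) ∣          ≡⟨ cong ∣_∣ (factor k l) ⟩
    ∣ + 2 * k - + 2 * l ∣      ≡⟨ cong (λ a → ∣ a - + 2 * l ∣) eq ⟩
    ∣ + 2 * l + 1ℤ - + 2 * l ∣ ≡⟨ cong ∣_∣ (cancel l) ⟩
    1                          ∎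
... | ()

neg-closed⇒∣∣-closed : ∀ (P : ℤ → Set) → (∀ {a} → P a → P (- a)) → ∀ {a} → P a → P (+ ∣ a ∣)
neg-closed⇒∣∣-closed P neg {+ n}      p = p
neg-closed⇒∣∣-closed P neg { -[1+ n ]} p = neg p

odd-∣∣≤-sharpen : ∀ {m} → Even (+ suc m) → ∀ {a} → Odd a → ∣ a ∣ ≤ suc m → ∣ a ∣ ≤ m
odd-∣∣≤-sharpen e o ∣a∣≤ = ℕₚ.m<1+n⇒m≤n (ℕₚ.≤∧≢⇒< ∣a∣≤ λ eq →
  even⇒¬odd (subst Even (sym (cong +_ eq)) e) (neg-closed⇒∣∣-closed Odd odd-neg o))

even-∣∣≤-sharpen : ∀ {m} → Odd (+ suc m) → ∀ {a} → Even a → ∣ a ∣ ≤ suc m → ∣ a ∣ ≤ m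
even-∣∣≤-sharpen o e ∣a∣≤ = ℕₚ.m<1+n⇒m≤n (ℕₚ.≤∧≢⇒< ∣a∣≤ λ eq →
  even⇒¬odd (neg-closed⇒∣∣-closed Even even-neg e) (subst Odd (sym (cong +_ eq)) o))

∣i∣+∣j∣≡∣i+j∣⊎∣i-j∣ : ∀ a b → ∣ a ∣ ℕ.+ ∣ b ∣ ≡ ∣ a + b ∣ ⊎ ∣ a ∣ ℕ.+ ∣ b ∣ ≡ ∣ a - b ∣
∣i∣+∣j∣≡∣i+j∣⊎∣i-j∣ (+ m)      (+ n)      = inj₁ refl
∣i∣+∣j∣≡∣i+j∣⊎∣i-j∣ (+ m)      -[1+ n ]   = inj₂ refl
∣i∣+∣j∣≡∣i+j∣⊎∣i-j∣ -[1+ m ]   (+ n)      = inj₂ (trans (ℕₚ.+-comm (suc m) n) (∣i-j∣≡∣j-i∣ (+ n) -[1+ m ]))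
∣i∣+∣j∣≡∣i+j∣⊎∣i-j∣ -[1+ m ]   -[1+ n ]   = inj₁ (cong suc (ℕₚ.+-suc m n))

between⇒∣∣≤ : ∀ {a b c n} → a ℤ.≤ b → b ℤ.≤ c → ∣ a ∣ ≤ n → ∣ c ∣ ≤ n → ∣ b ∣ ≤ n
between⇒∣∣≤ {b = + _}      _          (+≤+ b≤c) _     ∣c∣≤n = ℕₚ.≤-trans b≤c ∣c∣≤n
between⇒∣∣≤ {b = -[1+ _ ]} (-≤- b≤a) _          ∣a∣≤n _     = ℕₚ.≤-trans (s≤s b≤a) ∣a∣≤n

∣k-1∣≤ : ∀ {k m} → 1 ≤ m → k ≤ suc m → ∣ + k - 1ℤ ∣ ≤ m
∣k-1∣≤ {zero}  1≤m _   = 1≤m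
∣k-1∣≤ {suc k} _   k≤ = s≤s⁻¹ k≤

∣k-1+j∣≤ : ∀ k j {m} → ∣ + k + j ∣ ≤ m → ∣ j ∣ < m → ∣ (+ k - 1ℤ) + j ∣ ≤ m
∣k-1+j∣≤ k j {m} ∣k+j∣≤ ∣j∣< = between⇒∣∣≤ lower upper ∣j-1∣≤ ∣k+j∣≤
  where
  lower : j - 1ℤ ℤ.≤ (+ k - 1ℤ) + j
  lower = subst (ℤ._≤ (+ k - 1ℤ) + j) (+-comm -1ℤ j)
    (+-monoˡ-≤ j (+-monoˡ-≤ -1ℤ {0ℤ} {+ k} (+≤+ z≤n)))
  upper : (+ k - 1ℤ) + j ℤ.≤ + k + j
  upper = +-monoˡ-≤ j (i≤j⇒i-k≤j 1ℤ (ℤₚ.≤-refl {+ k}))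
  ∣j-1∣≤ : ∣ j - 1ℤ ∣ ≤ m
  ∣j-1∣≤ = ℕₚ.≤-trans (∣i-j∣≤∣i∣+∣j∣ j 1ℤ) (subst (_≤ m) (ℕₚ.+-comm 1 ∣ j ∣) ∣j∣<)

1+2*m≤2*[1+m] : ∀ m → suc (2 ℕ.* m) ≤ 2 ℕ.* suc m
1+2*m≤2*[1+m] m = ℕₚ.≤-trans (ℕₚ.n≤1+n _) (ℕₚ.≤-reflexive (sym (ℕₚ.*-suc 2 m)))

-- Arithmetic of ℤ[i]

⊕-identityˡ : ∀ z → zeroG ⊕ z ≡ z
⊕-identityˡ (x + y i) = cong₂ _+_i (+-identityˡ x) (+-identityˡ y)

⊕-identityʳ : ∀ z → z ⊕ zeroG ≡ z
⊕-identityʳ (x + y i) = cong₂ _+_i (+-identityʳ x) (+-identityʳ y)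

⊗-assoc : ∀ a b c → a ⊗ (b ⊗ c) ≡ (a ⊗ b) ⊗ c
⊗-assoc (a₁ + a₂ i) (b₁ + b₂ i) (c₁ + c₂ i) =
  cong₂ _+_i (re-assoc a₁ a₂ b₁ b₂ c₁ c₂) (im-assoc a₁ a₂ b₁ b₂ c₁ c₂)
  where
  re-assoc : ∀ a₁ a₂ b₁ b₂ c₁ c₂ →
    a₁ * (b₁ * c₁ - b₂ * c₂) - a₂ * (b₁ * c₂ + b₂ * c₁) ≡
    (a₁ * b₁ - a₂ * b₂) * c₁ - (a₁ * b₂ + a₂ * b₁) * c₂
  re-assoc = solve-∀
  im-assoc : ∀ a₁ a₂ b₁ b₂ c₁ c₂ →
    a₁ * (b₁ * c₂ + b₂ * c₁) + a₂ * (b₁ * c₁ - b₂ * c₂) ≡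
    (a₁ * b₁ - a₂ * b₂) * c₂ + (a₁ * b₂ + a₂ * b₁) * c₁
  im-assoc = solve-∀

im-⊗1+i : ∀ z → im (onePlusI ⊗ z) ≡ re z + im z
im-⊗1+i (x + y i) = identity x y
  where
  identity : ∀ x y → 1ℤ * y + 1ℤ * x ≡ x + y
  identity = solve-∀

1+i-divides : ∀ {z} → Even (re z + im z) → ∃[ q ] onePlusI ⊗ q ≡ z
1+i-divides {x + y i} (k , x+y≡2k) = k + (k - x) i , cong₂ _+_i (re-identity k x) im≡y
  where
  re-identity : ∀ k x → 1ℤ * k - 1ℤ * (k - x) ≡ x
  re-identity = solve-∀
  im-identity : ∀ k x → 1ℤ * (k - x) + 1ℤ * k ≡ + 2 * k - x
  im-identity = solve-∀
  cancel : ∀ x y → x + y - x ≡ y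
  cancel = solve-∀
  im≡y : 1ℤ * (k - x) + 1ℤ * k ≡ y
  im≡y = begin
    1ℤ * (k - x) + 1ℤ * k ≡⟨ im-identity k x ⟩
    + 2 * k - x           ≡⟨ cong (_- x) x+y≡2k ⟨
    x + y - x             ≡⟨ cancel x y ⟩
    y                     ∎

timesI : ℤ[i] → ℤ[i]
timesI (x + y i) = (- y) + x i

timesI⁴ : ∀ z → timesI (timesI (timesI (timesI z))) ≡ z
timesI⁴ (x + y i) = cong₂ _+_i (neg-involutive x) (neg-involutive y)

timesI-⊕ : ∀ a b → timesI (a ⊕ b) ≡ timesI a ⊕ timesI b
timesI-⊕ (a₁ + a₂ i) (b₁ + b₂ i) = cong (_+ (a₁ + b₁) i) (neg-distrib-+ a₂ b₂)

⊗-timesI : ∀ a b → a ⊗ timesI b ≡ timesI (a ⊗ b)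
⊗-timesI (a₁ + a₂ i) (b₁ + b₂ i) = cong₂ _+_i (re-identity a₁ a₂ b₁ b₂) (im-identity a₁ a₂ b₁ b₂)
  where
  re-identity : ∀ a₁ a₂ b₁ b₂ → a₁ * - b₂ - a₂ * b₁ ≡ - (a₁ * b₂ + a₂ * b₁)
  re-identity = solve-∀
  im-identity : ∀ a₁ a₂ b₁ b₂ → a₁ * b₁ + a₂ * - b₂ ≡ a₁ * b₁ - a₂ * b₂
  im-identity = solve-∀

-- Octagons

record Octagon (c d : ℕ) (z : ℤ[i]) : Set where
  constructor octagon
  field
    re≤   : ∣ re z ∣ ≤ c
    im≤   : ∣ im z ∣ ≤ c
    sum≤  : ∣ re z + im z ∣ ≤ d
    diff≤ : ∣ re z - im z ∣ ≤ d

Octagon-intro : ∀ {c d x y} → ∣ x ∣ ≤ c → ∣ y ∣ ≤ c → ∣ x ∣ ℕ.+ ∣ y ∣ ≤ d → Octagon c d (x + y i)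
Octagon-intro {x = x} {y} ∣x∣≤ ∣y∣≤ ∣x∣+∣y∣≤ = octagon ∣x∣≤ ∣y∣≤
  (ℕₚ.≤-trans (∣i+j∣≤∣i∣+∣j∣ x y) ∣x∣+∣y∣≤) (ℕₚ.≤-trans (∣i-j∣≤∣i∣+∣j∣ x y) ∣x∣+∣y∣≤)

Octagon⇒∣re∣+∣im∣≤ : ∀ {c d z} → Octagon c d z → ∣ re z ∣ ℕ.+ ∣ im z ∣ ≤ d
Octagon⇒∣re∣+∣im∣≤ {z = z} (octagon _ _ sum≤ diff≤) with ∣i∣+∣j∣≡∣i+j∣⊎∣i-j∣ (re z) (im z)
... | inj₁ eq = ℕₚ.≤-trans (ℕₚ.≤-reflexive eq) sum≤
... | inj₂ eq = ℕₚ.≤-trans (ℕₚ.≤-reflexive eq) diff≤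

Octagon-mono : ∀ {c c′ d d′ z} → c ≤ c′ → d ≤ d′ → Octagon c d z → Octagon c′ d′ z
Octagon-mono c≤ d≤ (octagon re≤ im≤ sum≤ diff≤) =
  octagon (ℕₚ.≤-trans re≤ c≤) (ℕₚ.≤-trans im≤ c≤) (ℕₚ.≤-trans sum≤ d≤) (ℕₚ.≤-trans diff≤ d≤)

Octagon-shrink : ∀ (P : ℤ → Set) {c d z} → (∀ {a} → P a → ∣ a ∣ ≤ suc c → ∣ a ∣ ≤ c) →
                 P (re z) → P (im z) → Octagon (suc c) d z → Octagon c d z
Octagon-shrink _ sharpen p-re p-im (octagon re≤ im≤ sum≤ diff≤) =
  octagon (sharpen p-re re≤) (sharpen p-im im≤) sum≤ diff≤

Octagon-⊕ : ∀ {c c′ d d′ z z′} → Octagon c d z → Octagon c′ d′ z′ →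
            Octagon (c ℕ.+ c′) (d ℕ.+ d′) (z ⊕ z′)
Octagon-⊕ {z = x + y i} {x′ + y′ i} (octagon re≤ im≤ sum≤ diff≤) (octagon re≤′ im≤′ sum≤′ diff≤′) =
  octagon (triangle x x′ re≤ re≤′) (triangle y y′ im≤ im≤′)
    (subst (λ a → ∣ a ∣ ≤ _) (sum-interchange x y x′ y′) (triangle (x + y) (x′ + y′) sum≤ sum≤′))
    (subst (λ a → ∣ a ∣ ≤ _) (diff-interchange x y x′ y′) (triangle (x - y) (x′ - y′) diff≤ diff≤′))
  where
  triangle : ∀ a b {m n} → ∣ a ∣ ≤ m → ∣ b ∣ ≤ n → ∣ a + b ∣ ≤ m ℕ.+ n
  triangle a b ∣a∣≤ ∣b∣≤ = ℕₚ.≤-trans (∣i+j∣≤∣i∣+∣j∣ a b) (ℕₚ.+-mono-≤ ∣a∣≤ ∣b∣≤)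
  sum-interchange : ∀ x y x′ y′ → (x + y) + (x′ + y′) ≡ (x + x′) + (y + y′)
  sum-interchange = solve-∀
  diff-interchange : ∀ x y x′ y′ → (x - y) + (x′ - y′) ≡ (x + x′) - (y + y′)
  diff-interchange = solve-∀

Octagon-halve : ∀ {c d p q} → Octagon (2 ℕ.* c) (2 ℕ.* d) ((+ 2 * p) + (+ 2 * q) i) → Octagon c d (p + q i)
Octagon-halve {p = p} {q} (octagon re≤ im≤ sum≤ diff≤) =
  octagon (half p re≤) (half q im≤)
    (half (p + q) (subst (λ a → ∣ a ∣ ≤ _) (factor-sum p q) sum≤))
    (half (p - q) (subst (λ a → ∣ a ∣ ≤ _) (factor-diff p q) diff≤))
  where
  half : ∀ a {m} → ∣ + 2 * a ∣ ≤ 2 ℕ.* m → ∣ a ∣ ≤ m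
  half a le = ℕₚ.*-cancelˡ-≤ 2 (subst (_≤ _) (∣i*j∣≡∣i∣*∣j∣ (+ 2) a) le)
  factor-sum : ∀ p q → + 2 * p + + 2 * q ≡ + 2 * (p + q)
  factor-sum = solve-∀
  factor-diff : ∀ p q → + 2 * p - + 2 * q ≡ + 2 * (p - q)
  factor-diff = solve-∀

∣∣-⊗1+i : ∀ z → let z′ = onePlusI ⊗ z in
  (∣ re z′ ∣ ≡ ∣ re z - im z ∣) × (∣ im z′ ∣ ≡ ∣ re z + im z ∣) ×
  (∣ re z′ + im z′ ∣ ≡ 2 ℕ.* ∣ re z ∣) × (∣ re z′ - im z′ ∣ ≡ 2 ℕ.* ∣ im z ∣)
∣∣-⊗1+i (x + y i) =
  cong ∣_∣ (re-form x y) , cong ∣_∣ (im-form x y) ,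
  trans (cong ∣_∣ (sum-form x y)) (∣i*j∣≡∣i∣*∣j∣ (+ 2) x) ,
  trans (cong ∣_∣ (diff-form x y)) (trans (∣-i∣≡∣i∣ (+ 2 * y)) (∣i*j∣≡∣i∣*∣j∣ (+ 2) y))
  where
  re-form : ∀ x y → 1ℤ * x - 1ℤ * y ≡ x - y
  re-form = solve-∀
  im-form : ∀ x y → 1ℤ * y + 1ℤ * x ≡ x + y
  im-form = solve-∀
  sum-form : ∀ x y → (1ℤ * x - 1ℤ * y) + (1ℤ * y + 1ℤ * x) ≡ + 2 * x
  sum-form = solve-∀
  diff-form : ∀ x y → (1ℤ * x - 1ℤ * y) - (1ℤ * y + 1ℤ * x) ≡ - (+ 2 * y)
  diff-form = solve-∀

Octagon-*1+i : ∀ {c d z} → Octagon c d z → Octagon d (2 ℕ.* c) (onePlusI ⊗ z)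
Octagon-*1+i {z = z} (octagon re≤ im≤ sum≤ diff≤) with ∣∣-⊗1+i z
... | ∣re∣ , ∣im∣ , ∣sum∣ , ∣diff∣ = octagon
  (subst (_≤ _) (sym ∣re∣) diff≤)
  (subst (_≤ _) (sym ∣im∣) sum≤)
  (subst (_≤ _) (sym ∣sum∣) (ℕₚ.*-monoʳ-≤ 2 re≤))
  (subst (_≤ _) (sym ∣diff∣) (ℕₚ.*-monoʳ-≤ 2 im≤))

Octagon-÷1+i : ∀ {c d h z} → d ≤ suc (2 ℕ.* h) → Octagon c d (onePlusI ⊗ z) → Octagon h c z
Octagon-÷1+i {d = d} {h} {z} d≤ (octagon re≤ im≤ sum≤ diff≤) with ∣∣-⊗1+i z
... | ∣re∣ , ∣im∣ , ∣sum∣ , ∣diff∣ = octagon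
  (half (subst (_≤ d) ∣sum∣ sum≤))
  (half (subst (_≤ d) ∣diff∣ diff≤))
  (subst (_≤ _) ∣im∣ im≤)
  (subst (_≤ _) ∣re∣ re≤)
  where
  half : ∀ {m} → 2 ℕ.* m ≤ d → m ≤ h
  half {m} 2m≤d = ℕₚ.m<1+n⇒m≤n (ℕₚ.*-cancelˡ-< 2 m (suc h)
    (subst (2 ℕ.* m <_) (sym (ℕₚ.*-suc 2 h)) (s≤s (ℕₚ.≤-trans 2m≤d d≤))))

digit-octagon : ∀ v → Octagon 1 1 (digitVal v)
digit-octagon d0  = octagon z≤n z≤n z≤n z≤n
digit-octagon d1  = octagon ℕₚ.≤-refl z≤n ℕₚ.≤-refl ℕₚ.≤-refl
digit-octagon d-1 = octagon ℕₚ.≤-refl z≤n ℕₚ.≤-refl ℕₚ.≤-refl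
digit-octagon di  = octagon z≤n ℕₚ.≤-refl ℕₚ.≤-refl ℕₚ.≤-refl
digit-octagon d-i = octagon z≤n ℕₚ.≤-refl ℕₚ.≤-refl ℕₚ.≤-refl

Octagon₁₁⇒digit : ∀ {z} → Octagon 1 1 z → ∃[ v ] z ≡ digitVal v
Octagon₁₁⇒digit {(+ suc (suc _)) + _ i}     (octagon (s≤s ()) _ _ _)
Octagon₁₁⇒digit {(-[1+ suc _ ]) + _ i}      (octagon (s≤s ()) _ _ _)
Octagon₁₁⇒digit {_ + (+ suc (suc _)) i}     (octagon _ (s≤s ()) _ _)
Octagon₁₁⇒digit {_ + (-[1+ suc _ ]) i}      (octagon _ (s≤s ()) _ _)
Octagon₁₁⇒digit {(+ 0) + (+ 0) i}           _ = d0 , refl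
Octagon₁₁⇒digit {(+ 1) + (+ 0) i}           _ = d1 , refl
Octagon₁₁⇒digit {(-[1+ 0 ]) + (+ 0) i}      _ = d-1 , refl
Octagon₁₁⇒digit {(+ 0) + (+ 1) i}           _ = di , refl
Octagon₁₁⇒digit {(+ 0) + (-[1+ 0 ]) i}      _ = d-i , refl
Octagon₁₁⇒digit {(+ 1) + (+ 1) i}           (octagon _ _ (s≤s ()) _)
Octagon₁₁⇒digit {(+ 1) + (-[1+ 0 ]) i}      (octagon _ _ _ (s≤s ()))
Octagon₁₁⇒digit {(-[1+ 0 ]) + (+ 1) i}      (octagon _ _ _ (s≤s ()))
Octagon₁₁⇒digit {(-[1+ 0 ]) + (-[1+ 0 ]) i} (octagon _ _ (s≤s ()) _)

Octagon-timesI : ∀ {c d z} → Octagon c d z → Octagon c d (timesI z)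
Octagon-timesI {z = x + y i} (octagon re≤ im≤ sum≤ diff≤) = octagon
  (subst (_≤ _) (sym (∣-i∣≡∣i∣ y)) im≤)
  re≤
  (subst (_≤ _) (cong ∣_∣ (+-comm x (- y))) diff≤)
  (subst (_≤ _) (trans (sym (∣-i∣≡∣i∣ (x + y))) (cong ∣_∣ (identity x y))) sum≤)
  where
  identity : ∀ x y → - (x + y) ≡ - y - x
  identity = solve-∀

-- Digit expansions

digit∈B₀ : ∀ v → InB 0 (digitVal v)
digit∈B₀ v = v ∷ [] , ⊕-identityʳ (digitVal v)

InB-cons : ∀ {n z} v → InB n z → InB (suc n) (digitVal v ⊕ onePlusI ⊗ z)
InB-cons v (vs , refl) = v ∷ vs , refl

timesI-digit : Digit → Digit
timesI-digit d0  = d0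
timesI-digit d1  = di
timesI-digit di  = d-1
timesI-digit d-1 = d-i
timesI-digit d-i = d1

digitVal-timesI : ∀ v → digitVal (timesI-digit v) ≡ timesI (digitVal v)
digitVal-timesI d0  = refl
digitVal-timesI d1  = refl
digitVal-timesI di  = refl
digitVal-timesI d-1 = refl
digitVal-timesI d-i = refl

evalDigits-timesI : ∀ {m} (vs : Vec Digit m) → evalDigits (map timesI-digit vs) ≡ timesI (evalDigits vs)
evalDigits-timesI []       = refl
evalDigits-timesI (v ∷ vs) = begin
  digitVal (timesI-digit v) ⊕ onePlusI ⊗ evalDigits (map timesI-digit vs)
    ≡⟨ cong₂ (λ a b → a ⊕ onePlusI ⊗ b) (digitVal-timesI v) (evalDigits-timesI vs) ⟩
  timesI (digitVal v) ⊕ onePlusI ⊗ timesI (evalDigits vs)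
    ≡⟨ cong (timesI (digitVal v) ⊕_) (⊗-timesI onePlusI (evalDigits vs)) ⟩
  timesI (digitVal v) ⊕ timesI (onePlusI ⊗ evalDigits vs)
    ≡⟨ timesI-⊕ (digitVal v) (onePlusI ⊗ evalDigits vs) ⟨
  timesI (digitVal v ⊕ onePlusI ⊗ evalDigits vs)
    ∎

InB-timesI : ∀ {n z} → InB n z → InB n (timesI z)
InB-timesI (vs , refl) = map timesI-digit vs , evalDigits-timesI vs

InB-timesI⁻¹ : ∀ {n z} → InB n (timesI z) → InB n z
InB-timesI⁻¹ {n} {z} b = subst (InB n) (timesI⁴ z) (InB-timesI (InB-timesI (InB-timesI b)))

box diag : ℕ → ℕ
box zero    = 1
box (suc n) = suc (diag n)
diag zero    = 1
diag (suc n) = suc (2 ℕ.* box n)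

w≡2+box : ∀ n → w n ≡ 2 ℕ.+ box n
w-suc≡3+diag : ∀ n → w (suc n) ≡ 3 ℕ.+ diag n
w≡2+box zero    = refl
w≡2+box (suc n) = w-suc≡3+diag n
w-suc≡3+diag zero    = refl
w-suc≡3+diag (suc n) = trans (cong (2 ℕ.*_) (w≡2+box n)) (ℕₚ.*-distribˡ-+ 2 2 (box n))

box≤diag : ∀ n → box n ≤ diag n
diag≤2box : ∀ n → diag n ≤ 2 ℕ.* box n
box≤diag zero    = ℕₚ.≤-refl
box≤diag (suc n) = s≤s (diag≤2box n)
diag≤2box zero    = s≤s z≤n
diag≤2box (suc n) = ℕₚ.≤-trans (s≤s (ℕₚ.*-monoʳ-≤ 2 (box≤diag n))) (1+2*m≤2*[1+m] (diag n))

diag-odd : ∀ n → Odd (+ diag n)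
diag-odd zero    = 0ℤ , refl
diag-odd (suc n) = odd-1+ (+ box n , pos-* 2 (box n))

diag≥1 : ∀ n → 1 ≤ diag n
diag≥1 zero    = s≤s z≤n
diag≥1 (suc n) = s≤s z≤n

+w-2≡box : ∀ n → + w n - + 2 ≡ + box n
+w-2≡box n = cong (λ m → + m - + 2) (w≡2+box n)

+w-suc-3≡diag : ∀ n → + w (suc n) - + 3 ≡ + diag n
+w-suc-3≡diag n = cong (λ m → + m - + 3) (w-suc≡3+diag n)

InOct⇒Octagon : ∀ n {z} → InOct n z → Octagon (box n) (diag n) z
InOct⇒Octagon n (re≤ , im≤ , sum≤) =
  Octagon-intro (bound (+w-2≡box n) re≤) (bound (+w-2≡box n) im≤) (bound (+w-suc-3≡diag n) sum≤)
  where
  bound : ∀ {a b c} → b ≡ + c → + a ℤ.≤ b → a ≤ c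
  bound refl = drop‿+≤+

Octagon⇒InOct : ∀ n {z} → Octagon (box n) (diag n) z → InOct n z
Octagon⇒InOct n o@(octagon re≤ im≤ _ _) =
  bound (+w-2≡box n) re≤ , bound (+w-2≡box n) im≤ , bound (+w-suc-3≡diag n) (Octagon⇒∣re∣+∣im∣≤ o)
  where
  bound : ∀ {a b c} → b ≡ + c → a ≤ c → + a ℤ.≤ b
  bound refl = +≤+

Octagon-enlarge : ∀ n {z} → Octagon (suc (box n)) (suc (diag n)) z → Octagon (box (suc n)) (diag (suc n)) z
Octagon-enlarge n = Octagon-mono (s≤s (box≤diag n)) (s≤s (diag≤2box n))

evalDigits-octagon : ∀ n (vs : Vec Digit (suc n)) → Octagon (box n) (diag n) (evalDigits vs)
evalDigits-octagon zero    (v ∷ []) = Octagon-⊕ (digit-octagon v) (octagon z≤n z≤n z≤n z≤n)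
evalDigits-octagon (suc n) (v ∷ vs) = Octagon-⊕ (digit-octagon v) (Octagon-*1+i (evalDigits-octagon n vs))


module InductionStep (n : ℕ)
  (ih : ∀ {z} → Octagon (box n) (diag n) z → ¬ (Even (re z) × Even (im z)) → InB n z) where

  sharpen-odd : ∀ {a} → Odd a → ∣ a ∣ ≤ suc (diag n) → ∣ a ∣ ≤ diag n
  sharpen-odd = odd-∣∣≤-sharpen (even-1+ (diag-odd n))

  peel-digit : ∀ v {t} → Octagon (diag n) (suc (2 ℕ.* box n)) t → Odd (re t) → Odd (im t) →
         InB (suc n) (digitVal v ⊕ t)
  peel-digit v {t} o ox oy with 1+i-divides {t} (odd+odd ox oy)
  ... | q , refl = InB-cons v (ih (Octagon-÷1+i {z = q} ℕₚ.≤-refl o) λ (ex , ey) →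
    even⇒¬odd (subst Even (sym (im-⊗1+i q)) (even+even ex ey)) oy)

  odd-odd : ∀ {z} → Octagon (box (suc n)) (diag (suc n)) z → Odd (re z) → Odd (im z) → InB (suc n) z
  odd-odd {z} o ox oy =
    subst (InB (suc n)) (⊕-identityˡ z) (peel-digit d0 (Octagon-shrink Odd sharpen-odd ox oy o) ox oy)

  even-odd⁺ : ∀ {k y} → Octagon (box (suc n)) (diag (suc n)) ((+ k) + y i) → Even (+ k) → Odd y →
              InB (suc n) ((+ k) + y i)
  even-odd⁺ {k} {y} (octagon re≤ im≤ sum≤ diff≤) ex oy =
    subst (InB (suc n)) (cong₂ _+_i (identity (+ k)) (+-identityˡ y)) (peel-digit d1 o′ (odd-pred ex) oy)
    where
    identity : ∀ a → 1ℤ + (a - 1ℤ) ≡ a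
    identity = solve-∀
    ∣y∣≤ : ∣ y ∣ ≤ diag n
    ∣y∣≤ = sharpen-odd oy im≤
    ∣y∣< : ∣ y ∣ < suc (2 ℕ.* box n)
    ∣y∣< = s≤s (ℕₚ.≤-trans ∣y∣≤ (diag≤2box n))
    o′ : Octagon (diag n) (suc (2 ℕ.* box n)) ((+ k - 1ℤ) + y i)
    o′ = octagon (∣k-1∣≤ (diag≥1 n) re≤) ∣y∣≤ (∣k-1+j∣≤ k y sum≤ ∣y∣<)
                 (∣k-1+j∣≤ k (- y) diff≤ (subst (_< _) (sym (∣-i∣≡∣i∣ y)) ∣y∣<))

  even-odd : ∀ {z} → Octagon (box (suc n)) (diag (suc n)) z → Even (re z) → Odd (im z) → InB (suc n) z
  even-odd {(+ k) + y i}      o ex oy = even-odd⁺ o ex oy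
  even-odd {(-[1+ k ]) + y i} o ex oy = InB-timesI⁻¹ (InB-timesI⁻¹
    (even-odd⁺ (Octagon-timesI (Octagon-timesI o)) (even-neg ex) (odd-neg oy)))

  step : ∀ {z} → Octagon (box (suc n)) (diag (suc n)) z → ¬ (Even (re z) × Even (im z)) → InB (suc n) z
  step {z} o ¬even with parity (re z) | parity (im z)
  ... | inj₁ ex | inj₁ ey = ⊥-elim (¬even (ex , ey))
  ... | inj₁ ex | inj₂ oy = even-odd o ex oy
  ... | inj₂ ox | inj₁ ey = InB-timesI⁻¹ (even-odd (Octagon-timesI o) (even-neg ey) ox)
  ... | inj₂ ox | inj₂ oy = odd-odd o ox oy

Octagon⇒B : ∀ n {z} → Octagon (box n) (diag n) z → ¬ (Even (re z) × Even (im z)) → InB n z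
Octagon⇒B zero o _ with Octagon₁₁⇒digit o
... | v , refl = digit∈B₀ v
Octagon⇒B (suc n) = InductionStep.step n (Octagon⇒B n)

InB⁺ : ℕ → ℤ[i] → Set
InB⁺ n z = InB (suc n) z ⊎ ∃[ u ] (IsUnit u × z ≡ pow1+i (suc (suc n)) ⊗ u)

InB⁺-*1+i : ∀ {n z} → InB⁺ n z → InB⁺ (suc n) (onePlusI ⊗ z)
InB⁺-*1+i {z = z} (inj₁ b) = inj₁ (subst (InB _) (⊕-identityˡ (onePlusI ⊗ z)) (InB-cons d0 b))
InB⁺-*1+i {n} (inj₂ (u , unit , refl)) = inj₂ (u , unit , ⊗-assoc onePlusI (pow1+i (suc (suc n))) u)

even-Octagon₂₂⇒B⁺ : ∀ {p q} → Octagon 2 2 ((+ 2 * p) + (+ 2 * q) i) → InB⁺ 0 ((+ 2 * p) + (+ 2 * q) i)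
even-Octagon₂₂⇒B⁺ o with Octagon₁₁⇒digit (Octagon-halve {c = 1} {d = 1} o)
... | d0  , refl = inj₁ (d0 ∷ d0 ∷ [] , refl)
... | d1  , refl = inj₂ (0ℤ + -1ℤ i , inj₂ (inj₂ (inj₂ refl)) , refl)
... | d-1 , refl = inj₂ (iG , inj₂ (inj₂ (inj₁ refl)) , refl)
... | di  , refl = inj₂ (oneG , inj₁ refl , refl)
... | d-i , refl = inj₂ (-1ℤ + 0ℤ i , inj₂ (inj₁ refl) , refl)

Octagon⇒B⁺ : ∀ n {z} → Octagon (suc (box n)) (suc (diag n)) z → InB⁺ n z
even-Octagon⇒B⁺ : ∀ n {z} → Octagon (suc (box n)) (suc (diag n)) z → Even (re z) → Even (im z) → InB⁺ n z

Octagon⇒B⁺ n {z} o with parity (re z) | parity (im z)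
... | inj₁ ex | inj₁ ey = even-Octagon⇒B⁺ n o ex ey
... | inj₁ _  | inj₂ oy = inj₁ (Octagon⇒B (suc n) (Octagon-enlarge n o) λ (_ , ey) → even⇒¬odd ey oy)
... | inj₂ ox | _       = inj₁ (Octagon⇒B (suc n) (Octagon-enlarge n o) λ (ex , _) → even⇒¬odd ex ox)

even-Octagon⇒B⁺ zero    {x + y i} o (p , refl) (q , refl) = even-Octagon₂₂⇒B⁺ o
even-Octagon⇒B⁺ (suc n) {z} o ex ey with 1+i-divides {z} (even+even ex ey)
... | q , refl = InB⁺-*1+i (Octagon⇒B⁺ n (Octagon-÷1+i {z = q} (s≤s (1+2*m≤2*[1+m] (box n))) o′))
  where
  o′ : Octagon (suc (diag n)) (suc (suc (2 ℕ.* box n))) (onePlusI ⊗ q)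
  o′ = Octagon-shrink Even (even-∣∣≤-sharpen (odd-1+ (even-1+ (diag-odd n)))) ex ey o

mainTheorem4 : (n : ℕ) →
    ((z : ℤ[i]) → InB n z → InOct n z) ×
    ((z : ℤ[i]) → InOct n z →
       InB (suc n) z ⊎ (∃[ u ] (IsUnit u × z ≡ pow1+i (suc (suc n)) ⊗ u))) ×
    ((z : ℤ[i]) → InOct n z → ¬ (Even (re z) × Even (im z)) → InB n z)
mainTheorem4 n =
    (λ z (vs , evalDigits≡z) → subst (InOct n) evalDigits≡z (Octagon⇒InOct n (evalDigits-octagon n vs)))
  , (λ z z∈Oct → Octagon⇒B⁺ n (Octagon-mono (ℕₚ.n≤1+n _) (ℕₚ.n≤1+n _) (InOct⇒Octagon n z∈Oct)))
  , (λ z z∈Oct → Octagon⇒B n (InOct⇒Octagon n z∈Oct))
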